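{- Fix an integer $h\ge1$. As formal multivariate Dirichlet series, $$\mathcal Z(s_1,\dots,s_h)^{ -1}=\sum_{(1,\dots,1)\preceq(n_1,\dots,n_h)}\frac{\mu^h\big((1,\dots,1),(n_1,\dots,n_h)\big)}{n_1^{s_1}\cdots n_h^{s_h}},$$ where the sum runs over partitions $(n_1,\dots,n_h)$ of height $h$ with $(1,\dots,1)\preceq(n_1,\dots,n_h)$.
   Context: $\mathcal Z(s_1,\dots,s_h)=\sum_{n_1\ge\dots\ge n_h\ge1}\frac{1}{n_1^{s_1}\cdots n_h^{s_h}}$ is the large multizeta function, viewed as a formal Dirichlet series in $s_1,\dots,s_h$ (multiplication via $n^{ -s}m^{ -s}=(nm)^{ -s}$ in each variable). A partition of height $h$ is a sequence $\lambda_1\ge\dots\ge\lambda_h\ge1$ of integers. An espalier of height $h$ is a set of cells of $\mathbb Z^3$ of the form $\bigcup_{a=0}^{h-1}\{a\}\times\{0,\dots,p_a-1\}\times\{0,\dots,q_a-1\}$ with integers $p_0\ge\dots\ge p_{h-1}\ge1$, $q_0\ge\dots\ge q_{h-1}\ge1$; its multivolume is $mv(\mathbb E)=(p_0q_0,\dots,p_{h-1}q_{h-1})$ and $\lambda_x(\mathbb E)=(q_0,\dots,q_{h-1})$. For partitions $\lambda,\mu$ of height $h$, $\lambda\preceq\mu$ means there is an espalier $\mathbb E$ with $mv(\mathbb E)=\mu$ and $\lambda_x(\mathbb E)=\lambda$; this is a partial order on partitions of height $h$, and $\mu^h$ denotes its Möbius function. -}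

module Defs where

open import Data.Bool using (Bool; true; false; if_then_else_)
open import Data.Nat as ℕ using (ℕ; zero; suc; _≤_; _≤?_; _*_; _≡ᵇ_)
open import Data.Nat.Properties using (≤-trans; _≟_)
open import Data.Nat.DivMod using (_/_; m*n/n≡m)
open import Data.Nat.Divisibility using (_∣?_)
open import Data.Integer as ℤ using (ℤ)
open import Data.Vec as Vec using (Vec; []; _∷_; zipWith; replicate)
open import Data.Vec.Properties using (≡-dec)
open import Data.List as List using (List; []; _∷_; concatMap; map; filter; upTo; foldr)
open import Data.Product using (Σ; _×_; _,_; proj₁; proj₂)
open import Data.Unit using (⊤; tt)
open import Relation.Nullary using (Dec; yes; no; ¬_; ¬?)
open import Relation.Nullary.Decidable using (_×-dec_; ⌊_⌋)
open import Relation.Binary.PropositionalEquality using (_≡_; refl; cong; cong₂; subst; trans; sym)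

IsPartition : ∀ {h} → Vec ℕ h → Set
IsPartition [] = ⊤
IsPartition (x ∷ []) = 1 ≤ x
IsPartition (x ∷ y ∷ xs) = y ≤ x × IsPartition (y ∷ xs)

isPartition? : ∀ {h} (v : Vec ℕ h) → Dec (IsPartition v)
isPartition? [] = yes tt
isPartition? (x ∷ []) = 1 ≤? x
isPartition? (x ∷ y ∷ xs) = (y ≤? x) ×-dec isPartition? (y ∷ xs)

-- Espaliers of height h, given by p₀ ≥ ⋯ ≥ p_{h-1} ≥ 1, q₀ ≥ ⋯ ≥ q_{h-1} ≥ 1
-- (the set of cells ⋃_a {a}×{0..p_a-1}×{0..q_a-1} is determined by (p,q)).

record Espalier (h : ℕ) : Set where
  field
    p : Vec ℕ h
    q : Vec ℕ h
    p-part : IsPartition p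
    q-part : IsPartition q

mv : ∀ {h} → Espalier h → Vec ℕ h
mv E = zipWith _*_ (Espalier.p E) (Espalier.q E)

λx : ∀ {h} → Espalier h → Vec ℕ h
λx E = Espalier.q E

_⪯_ : ∀ {h} → Vec ℕ h → Vec ℕ h → Set
_⪯_ {h} l m = Σ (Espalier h) (λ E → mv E ≡ m × λx E ≡ l)

sdiv : ℕ → ℕ → ℕ
sdiv m zero = 0
sdiv m (suc n) = m / suc n

private
  head-pos : ∀ {h} x (xs : Vec ℕ h) → IsPartition (x ∷ xs) → 1 ≤ x
  head-pos x [] p = p
  head-pos x (y ∷ xs) (y≤x , r) = ≤-trans (head-pos y xs r) y≤x

  tail-part : ∀ {h} x (xs : Vec ℕ h) → IsPartition (x ∷ xs) → IsPartition xs
  tail-part x [] _ = tt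
  tail-part x (y ∷ xs) (_ , r) = r

  cellq : ∀ a x → 1 ≤ x → sdiv (a * x) x ≡ a
  cellq a (suc x) _ = m*n/n≡m a (suc x)

  uniq : ∀ {h} (p l : Vec ℕ h) → IsPartition l → zipWith sdiv (zipWith _*_ p l) l ≡ p
  uniq [] [] _ = refl
  uniq (a ∷ ps) (x ∷ ls) pl =
    cong₂ _∷_ (cellq a x (head-pos x ls pl)) (uniq ps ls (tail-part x ls pl))

  helper1 : ∀ {h} (l m : Vec ℕ h) → IsPartition l → (E : Espalier h) →
            mv E ≡ m → λx E ≡ l → zipWith sdiv m l ≡ Espalier.p E
  helper1 l m pl E refl refl = uniq (Espalier.p E) (Espalier.q E) pl

  helper2 : ∀ {h} (l m : Vec ℕ h) → IsPartition l → (E : Espalier h) →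
            mv E ≡ m → λx E ≡ l → zipWith _*_ (zipWith sdiv m l) l ≡ m
  helper2 l m pl E refl refl =
    cong (λ v → zipWith _*_ v (Espalier.q E)) (uniq (Espalier.p E) (Espalier.q E) pl)

_⪯?_ : ∀ {h} (l m : Vec ℕ h) → Dec (l ⪯ m)
l ⪯? m with isPartition? l
... | no ¬pl = no λ { (E , _ , eq) → ¬pl (subst IsPartition eq (Espalier.q-part E)) }
... | yes pl with isPartition? (zipWith sdiv m l) | ≡-dec _≟_ (zipWith _*_ (zipWith sdiv m l) l) m
... | yes pp | yes eq = yes (record { p = zipWith sdiv m l ; q = l ; p-part = pp ; q-part = pl } , eq , refl)
... | no ¬pp | _ = no λ { (E , e1 , e2) → ¬pp (subst IsPartition (sym (helper1 l m pl E e1 e2)) (Espalier.p-part E)) }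
... | yes _ | no ¬eq = no λ { (E , e1 , e2) → ¬eq (helper2 l m pl E e1 e2) }

sumℤ : List ℤ → ℤ
sumℤ = foldr ℤ._+_ ℤ.0ℤ

range1 : ℕ → List ℕ
range1 n = map suc (upTo n)

divisors : ℕ → List ℕ
divisors n = filter (_∣? n) (range1 n)

divTuples : ∀ {h} → Vec ℕ h → List (Vec ℕ h)
divTuples [] = [] ∷ []
divTuples (x ∷ xs) = concatMap (λ d → map (d ∷_) (divTuples xs)) (divisors x)

pairs : ℕ → List (ℕ × ℕ)
pairs n = concatMap (λ d → concatMap (λ e → if (d * e ≡ᵇ n) then (d , e) ∷ [] else []) (range1 n)) (range1 n)

factorTuples : ∀ {h} → Vec ℕ h → List (Vec ℕ h × Vec ℕ h)
factorTuples [] = ([] , []) ∷ []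
factorTuples (x ∷ xs) =
  concatMap (λ de → map (λ des → (proj₁ de ∷ proj₁ des , proj₂ de ∷ proj₂ des)) (factorTuples xs)) (pairs x)

prodV : ∀ {h} → Vec ℕ h → ℕ
prodV = Vec.foldr _ _*_ 1

-- Every z ⪯ y has z_a ∣ y_a, so z ranges over (the ⪯-filtered) divTuples y.  The recursion is
-- run with fuel; fuel suc (prodV y) always suffices, since z ≺ y strictly
-- implies prodV z < prodV y.

mobF : ∀ {h} → ℕ → Vec ℕ h → Vec ℕ h → ℤ
mobF zero x y = ℤ.0ℤ
mobF (suc k) x y with x ⪯? y
... | no _ = ℤ.0ℤ
... | yes _ with ≡-dec _≟_ x y
... | yes _ = ℤ.1ℤ
... | no _ = ℤ.- sumℤ (map (mobF k x) (filter (λ z → (x ⪯? z) ×-dec ((z ⪯? y) ×-dec ¬? (≡-dec _≟_ z y))) (divTuples y)))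

μʰ : ∀ {h} → Vec ℕ h → Vec ℕ h → ℤ
μʰ x y = mobF (suc (prodV y)) x y

-- Formal Dirichlet series in h variables: coefficient of n₁^{-s₁}⋯n_h^{-s_h}
-- at index (n₁,…,n_h) (only indices with all n_a ≥ 1 are meaningful).

DS : ℕ → Set
DS h = Vec ℕ h → ℤ

-- product: n^{-s} m^{-s} = (nm)^{-s} in each variable (Dirichlet convolution)
_⋆_ : ∀ {h} → DS h → DS h → DS h
(f ⋆ g) n = sumℤ (map (λ de → f (proj₁ de) ℤ.* g (proj₂ de)) (factorTuples n))

𝟙 : ∀ {h} → DS h
𝟙 {h} n = if ⌊ ≡-dec _≟_ n (replicate h 1) ⌋ then ℤ.1ℤ else ℤ.0ℤ

-- large multizeta 𝒵(s₁,…,s_h) = Σ_{n₁ ≥ ⋯ ≥ n_h ≥ 1} n₁^{-s₁}⋯n_h^{-s_h}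
𝒵 : ∀ {h} → DS h
𝒵 n = if ⌊ isPartition? n ⌋ then ℤ.1ℤ else ℤ.0ℤ

𝓜 : ∀ {h} → DS h
𝓜 {h} n = if ⌊ replicate h 1 ⪯? n ⌋ then μʰ (replicate h 1) n else ℤ.0ℤ

Positive : ∀ {h} → Vec ℕ h → Set
Positive [] = ⊤
Positive (x ∷ xs) = 1 ≤ x × Positive xs

module Submission where

-- Write n ⊘ z for the componentwise quotient of index tuples.  The whole proof
-- rests on one observation about espaliers: an espalier E with λx(E) = z and
-- mv(E) = n is determined by its p-vector n ⊘ z, so for z dividing n
-- componentwise,  z ⪯ n  holds exactly when z and n ⊘ z are both partitions.
-- Hence, for the Dirichlet convolution,
--   (𝓜 ⋆ 𝒵)(n) = Σ_{z ∣ n} 𝓜(z) 𝒵(n ⊘ z) = Σ_{1 ⪯ z ⪯ n} μʰ(1, z),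
-- and likewise for 𝒵 ⋆ 𝓜; the right-hand side is 1 if n = (1,…,1) and 0
-- otherwise, by the defining recursion of the Möbius function of (⪯).

open import Defs
open import Data.Bool using (Bool; true; false; if_then_else_)
open import Data.Nat using (ℕ; zero; suc; _≤_; _<_; s≤s; z≤n; _≡ᵇ_; _*_; >-nonZero)
open import Data.Nat.Properties
  using (_≟_; suc-injective; *-commutativeSemigroup; *-comm; *-assoc; *-identityˡ; *-mono-≤; *-cancelʳ-≡;
         m≤m*n; m<m*n; m*n≡1⇒m≡1; m*n≡1⇒n≡1; ≤-refl; ≤-trans; ≤∧≢⇒<; <-asym; 1+n≢0)
open import Data.Nat.Divisibility using (_∣_; divides; _∣?_; 0∣⇒≡0; ∣-refl)
open import Data.Nat.DivMod using (_/_; m*n/n≡m; m/n*n≡m)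
open import Data.Integer as ℤ using (ℤ; 0ℤ; 1ℤ; _+_; -_)
import Data.Integer.Properties as ℤP
open import Algebra.Properties.CommutativeSemigroup ℤP.+-commutativeSemigroup
  using () renaming (interchange to +-interchange)
open import Algebra.Properties.CommutativeSemigroup *-commutativeSemigroup
  using () renaming (interchange to *-interchange)
open import Data.Vec using (Vec; []; _∷_; zipWith; replicate)
open import Data.Vec.Properties
  using (≡-dec; ∷-injectiveˡ; ∷-injectiveʳ; zipWith-identityˡ; zipWith-assoc)
open import Data.List using (List; []; _∷_; _++_; map; filter; concatMap; upTo; applyUpTo)
open import Data.List.Properties using (map-applyUpTo)
open import Data.List.Relation.Unary.All as All using (All; []; _∷_)
open import Data.List.Relation.Unary.All.Properties using (all-filter; concat⁺; map⁺)
open import Data.Product using (_×_; _,_; proj₁; proj₂)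
open import Data.Unit using (tt)
open import Relation.Nullary using (Dec; yes; no; does; ¬_; ¬?; contradiction)
open import Relation.Nullary.Decidable using (_×-dec_; ⌊_⌋; dec-true; dec-false)
open import Relation.Unary using (Decidable)
open import Relation.Binary.PropositionalEquality
open import Function using (_∘_; id)
open ≡-Reasoning

∑ : {A : Set} → List A → (A → ℤ) → ℤ
∑ L f = sumℤ (map f L)

∑-cong : ∀ {A : Set} (L : List A) {f g : A → ℤ} → (∀ a → f a ≡ g a) → ∑ L f ≡ ∑ L g
∑-cong [] eq = refl
∑-cong (a ∷ L) eq = cong₂ _+_ (eq a) (∑-cong L eq)

∑-congAll : ∀ {A : Set} {P : A → Set} (L : List A) {f g : A → ℤ} →
  All P L → (∀ a → P a → f a ≡ g a) → ∑ L f ≡ ∑ L g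
∑-congAll [] [] eq = refl
∑-congAll (a ∷ L) (pa ∷ pL) eq = cong₂ _+_ (eq a pa) (∑-congAll L pL eq)

∑-zero : ∀ {A : Set} (L : List A) {f : A → ℤ} → (∀ a → f a ≡ 0ℤ) → ∑ L f ≡ 0ℤ
∑-zero [] eq = refl
∑-zero (a ∷ L) eq = cong₂ _+_ (eq a) (∑-zero L eq)

∑-++ : ∀ {A : Set} (L M : List A) (f : A → ℤ) → ∑ (L ++ M) f ≡ ∑ L f + ∑ M f
∑-++ [] M f = sym (ℤP.+-identityˡ _)
∑-++ (a ∷ L) M f = trans (cong (f a +_) (∑-++ L M f)) (sym (ℤP.+-assoc (f a) _ _))

∑-concatMap : ∀ {A B : Set} (g : A → List B) (L : List A) (f : B → ℤ) →
  ∑ (concatMap g L) f ≡ ∑ L (λ a → ∑ (g a) f)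
∑-concatMap g [] f = refl
∑-concatMap g (a ∷ L) f = trans (∑-++ (g a) (concatMap g L) f) (cong (∑ (g a) f +_) (∑-concatMap g L f))

∑-map : ∀ {A B : Set} (g : A → B) (L : List A) (f : B → ℤ) → ∑ (map g L) f ≡ ∑ L (f ∘ g)
∑-map g [] f = refl
∑-map g (a ∷ L) f = cong (f (g a) +_) (∑-map g L f)

∑-+ : ∀ {A : Set} (L : List A) (f g : A → ℤ) → ∑ L (λ a → f a + g a) ≡ ∑ L f + ∑ L g
∑-+ [] f g = refl
∑-+ (a ∷ L) f g =
  trans (cong ((f a + g a) +_) (∑-+ L f g)) (+-interchange (f a) (g a) (∑ L f) (∑ L g))

∑-filter : ∀ {A : Set} {P : A → Set} (P? : Decidable P) (L : List A) (f : A → ℤ) →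
  ∑ (filter P? L) f ≡ ∑ L (λ a → if does (P? a) then f a else 0ℤ)
∑-filter P? [] f = refl
∑-filter P? (a ∷ L) f with does (P? a)
... | true = cong (f a +_) (∑-filter P? L f)
... | false = trans (∑-filter P? L f) (sym (ℤP.+-identityˡ _))

∑-swap : ∀ {A B : Set} (L : List A) (M : List B) (f : A → B → ℤ) →
  ∑ L (λ a → ∑ M (f a)) ≡ ∑ M (λ b → ∑ L (λ a → f a b))
∑-swap [] M f = sym (∑-zero M (λ _ → refl))
∑-swap (a ∷ L) M f = trans (cong (∑ M (f a) +_) (∑-swap L M f)) (sym (∑-+ M (f a) _))

-- pairs is built from conditional singletons.
∑-if-singleton : ∀ {A : Set} (b : Bool) (a : A) (f : A → ℤ) →
  ∑ (if b then a ∷ [] else []) f ≡ (if b then f a else 0ℤ)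
∑-if-singleton true a f = ℤP.+-identityʳ _
∑-if-singleton false a f = refl

if-yes : ∀ {A : Set} (D : Dec A) {X Y : ℤ} → A → (if does D then X else Y) ≡ X
if-yes D {X} {Y} a = cong (if_then X else Y) (dec-true D a)

if-no : ∀ {A : Set} (D : Dec A) {X Y : ℤ} → ¬ A → (if does D then X else Y) ≡ Y
if-no D {X} {Y} ¬a = cong (if_then X else Y) (dec-false D ¬a)

∑-applyUpTo-zero : ∀ {A : Set} n (g : ℕ → A) (f : A → ℤ) → (∀ e → f (g e) ≡ 0ℤ) →
  ∑ (applyUpTo g n) f ≡ 0ℤ
∑-applyUpTo-zero zero g f off = refl
∑-applyUpTo-zero (suc n) g f off = cong₂ _+_ (off 0) (∑-applyUpTo-zero n (g ∘ suc) f (off ∘ suc))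

∑-applyUpTo-delta : ∀ {A : Set} n q (g : ℕ → A) (f : A → ℤ) → q < n →
  (∀ e → e ≢ q → f (g e) ≡ 0ℤ) → ∑ (applyUpTo g n) f ≡ f (g q)
∑-applyUpTo-delta (suc n) zero g f _ off =
  trans (cong (f (g 0) +_) (∑-applyUpTo-zero n (g ∘ suc) f (λ e → off (suc e) (λ ())))) (ℤP.+-identityʳ _)
∑-applyUpTo-delta (suc n) (suc q) g f (s≤s q<n) off =
  trans (cong₂ _+_ (off 0 (λ ())) (∑-applyUpTo-delta n q (g ∘ suc) f q<n (λ e e≢q → off (suc e) (e≢q ∘ suc-injective))))
        (ℤP.+-identityˡ _)

∑-range1-delta : ∀ n q (f : ℕ → ℤ) → 1 ≤ q → q ≤ n → (∀ e → e ≢ q → f e ≡ 0ℤ) → ∑ (range1 n) f ≡ f q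
∑-range1-delta n (suc q) f _ q<n off = begin
    ∑ (map suc (upTo n)) f  ≡⟨ cong (λ L → ∑ L f) (map-applyUpTo id suc n) ⟩
    ∑ (applyUpTo suc n) f   ≡⟨ ∑-applyUpTo-delta n q suc f q<n (λ e e≢q → off (suc e) (e≢q ∘ suc-injective)) ⟩
    f (suc q)               ∎

-- Componentwise quotient of index tuples (division by 0 gives 0).
_⊘_ : ∀ {h} → Vec ℕ h → Vec ℕ h → Vec ℕ h
n ⊘ z = zipWith sdiv n z

_∣ᵥ_ : ∀ {h} → Vec ℕ h → Vec ℕ h → Set
z ∣ᵥ n = zipWith _*_ (n ⊘ z) z ≡ n

-- Division is exact on divisors (and 0 / 0 = 0 is harmless).
sdiv-∣ : ∀ {d x} → d ∣ x → sdiv x d * d ≡ x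
sdiv-∣ {zero} d∣x = sym (0∣⇒≡0 d∣x)
sdiv-∣ {suc d} d∣x = m/n*n≡m d∣x

-- For fixed d, the indicator of d·e = x, summed over e ∈ [1, x], selects the
-- single cofactor e = x/d when d ∣ x, and nothing otherwise.  (The test
-- m ≡ᵇ n is definitionally does (m ≟ n), so if-yes/if-no apply to it.)
∑-cofactor : ∀ x d (g : ℕ → ℤ) → 1 ≤ x → (d∣?x : Dec (d ∣ x)) →
  ∑ (range1 x) (λ e → if d * e ≡ᵇ x then g e else 0ℤ) ≡ (if does d∣?x then g (sdiv x d) else 0ℤ)
∑-cofactor (suc x) zero g _ d∣?x =
  trans (∑-zero (range1 (suc x)) (λ _ → refl)) (sym (if-no d∣?x (1+n≢0 ∘ 0∣⇒≡0)))
∑-cofactor (suc x) (suc d) g _ (no d∤x) = ∑-zero (range1 (suc x))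
  (λ e → if-no (suc d * e ≟ suc x) (λ de≡x → d∤x (divides e (trans (sym de≡x) (*-comm (suc d) e)))))
∑-cofactor (suc x) (suc d) g _ (yes (divides zero ()))
∑-cofactor (suc x) (suc d) g _ (yes (divides (suc q) x≡qd)) = begin
    ∑ (range1 (suc x)) term  ≡⟨ ∑-range1-delta (suc x) (suc q) term (s≤s z≤n) q≤x off-q ⟩
    term (suc q)             ≡⟨ if-yes (suc d * suc q ≟ suc x) (trans (*-comm (suc d) (suc q)) (sym x≡qd)) ⟩
    g (suc q)                ≡⟨ cong g (trans (cong (_/ suc d) x≡qd) (m*n/n≡m (suc q) (suc d))) ⟨
    g (suc x / suc d)        ∎
  where
  term : ℕ → ℤ
  term e = if suc d * e ≡ᵇ suc x then g e else 0ℤ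
  q≤x : suc q ≤ suc x
  q≤x = subst (suc q ≤_) (sym x≡qd) (m≤m*n (suc q) (suc d))
  off-q : ∀ e → e ≢ suc q → term e ≡ 0ℤ
  off-q e e≢q = if-no (suc d * e ≟ suc x)
    (λ de≡x → e≢q (*-cancelʳ-≡ e (suc q) (suc d) (trans (*-comm e (suc d)) (trans de≡x x≡qd))))

∑-pairs : ∀ x (g : ℕ × ℕ → ℤ) →
  ∑ (pairs x) g ≡ ∑ (range1 x) (λ d → ∑ (range1 x) (λ e → if d * e ≡ᵇ x then g (d , e) else 0ℤ))
∑-pairs x g = trans (∑-concatMap row R g)
  (∑-cong R (λ d → trans (∑-concatMap (cell d) R g) (∑-cong R (λ e → ∑-if-singleton (d * e ≡ᵇ x) (d , e) g))))
  where
  R : List ℕ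
  R = range1 x
  cell : ℕ → ℕ → List (ℕ × ℕ)
  cell d e = if d * e ≡ᵇ x then (d , e) ∷ [] else []
  row : ℕ → List (ℕ × ℕ)
  row d = concatMap (cell d) R

∑-grid-divisors : ∀ x (G : ℕ → ℕ → ℤ) → 1 ≤ x →
  ∑ (range1 x) (λ d → ∑ (range1 x) (λ e → if d * e ≡ᵇ x then G d e else 0ℤ)) ≡
  ∑ (divisors x) (λ d → G d (sdiv x d))
∑-grid-divisors x G 1≤x = begin
    ∑ R (λ d → ∑ R (λ e → if d * e ≡ᵇ x then G d e else 0ℤ))
  ≡⟨ ∑-cong R (λ d → ∑-cofactor x d (G d) 1≤x (d ∣? x)) ⟩
    ∑ R (λ d → if does (d ∣? x) then G d (sdiv x d) else 0ℤ)
  ≡⟨ ∑-filter (_∣? x) R (λ d → G d (sdiv x d)) ⟨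
    ∑ (divisors x) (λ d → G d (sdiv x d)) ∎
  where
  R : List ℕ
  R = range1 x

∑-pairs-left : ∀ x (g : ℕ × ℕ → ℤ) → ∑ (pairs x) g ≡ ∑ (divisors x) (λ d → g (d , sdiv x d))
∑-pairs-left zero g = refl
∑-pairs-left (suc x) g =
  trans (∑-pairs (suc x) g) (∑-grid-divisors (suc x) (λ d e → g (d , e)) (s≤s z≤n))

∑-pairs-right : ∀ x (g : ℕ × ℕ → ℤ) → ∑ (pairs x) g ≡ ∑ (divisors x) (λ e → g (sdiv x e , e))
∑-pairs-right zero g = refl
∑-pairs-right (suc x) g = begin
    ∑ (pairs (suc x)) g
  ≡⟨ ∑-pairs (suc x) g ⟩
    ∑ R (λ d → ∑ R (λ e → if d * e ≡ᵇ suc x then g (d , e) else 0ℤ))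
  ≡⟨ ∑-swap R R (λ d e → if d * e ≡ᵇ suc x then g (d , e) else 0ℤ) ⟩
    ∑ R (λ e → ∑ R (λ d → if d * e ≡ᵇ suc x then g (d , e) else 0ℤ))
  ≡⟨ ∑-cong R (λ e → ∑-cong R (λ d → cong (λ t → if t ≡ᵇ suc x then g (d , e) else 0ℤ) (*-comm d e))) ⟩
    ∑ R (λ e → ∑ R (λ d → if e * d ≡ᵇ suc x then g (d , e) else 0ℤ))
  ≡⟨ ∑-grid-divisors (suc x) (λ e d → g (d , e)) (s≤s z≤n) ⟩
    ∑ (divisors (suc x)) (λ e → g (sdiv (suc x) e , e)) ∎
  where
  R : List ℕ
  R = range1 (suc x)

∑-divTuples-∷ : ∀ {h} x (xs : Vec ℕ h) (f : Vec ℕ (suc h) → ℤ) →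
  ∑ (divTuples (x ∷ xs)) f ≡ ∑ (divisors x) (λ d → ∑ (divTuples xs) (λ zs → f (d ∷ zs)))
∑-divTuples-∷ x xs f =
  trans (∑-concatMap (λ d → map (d ∷_) (divTuples xs)) (divisors x) f)
        (∑-cong (divisors x) (λ d → ∑-map (d ∷_) (divTuples xs) f))

∑-factorTuples : (l r : ℕ → ℕ → ℕ) →
  (∀ x (g : ℕ × ℕ → ℤ) → ∑ (pairs x) g ≡ ∑ (divisors x) (λ d → g (l x d , r x d))) →
  ∀ {h} (n : Vec ℕ h) (F : Vec ℕ h × Vec ℕ h → ℤ) →
  ∑ (factorTuples n) F ≡ ∑ (divTuples n) (λ z → F (zipWith l n z , zipWith r n z))
∑-factorTuples l r ∑-pairs-lr [] F = refl
∑-factorTuples l r ∑-pairs-lr (x ∷ xs) F = begin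
    ∑ (factorTuples (x ∷ xs)) F
  ≡⟨ ∑-concatMap extend (pairs x) F ⟩
    ∑ (pairs x) (λ de → ∑ (extend de) F)
  ≡⟨ ∑-cong (pairs x) (λ de → trans (∑-map (prepend de) (factorTuples xs) F)
                                    (∑-factorTuples l r ∑-pairs-lr xs (F ∘ prepend de))) ⟩
    ∑ (pairs x) (λ de → ∑ (divTuples xs) (λ zs → F (prepend de (zipWith l xs zs , zipWith r xs zs))))
  ≡⟨ ∑-pairs-lr x _ ⟩
    ∑ (divisors x) (λ d → ∑ (divTuples xs) (λ zs → F (zipWith l (x ∷ xs) (d ∷ zs) , zipWith r (x ∷ xs) (d ∷ zs))))
  ≡⟨ ∑-divTuples-∷ x xs _ ⟨
    ∑ (divTuples (x ∷ xs)) (λ z → F (zipWith l (x ∷ xs) z , zipWith r (x ∷ xs) z)) ∎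
  where
  prepend : ∀ {k} → ℕ × ℕ → Vec ℕ k × Vec ℕ k → Vec ℕ (suc k) × Vec ℕ (suc k)
  prepend de des = (proj₁ de ∷ proj₁ des , proj₂ de ∷ proj₂ des)
  extend : ℕ × ℕ → List (Vec ℕ _ × Vec ℕ _)
  extend de = map (prepend de) (factorTuples xs)

zipWith-second : ∀ {h} (n z : Vec ℕ h) → zipWith (λ _ d → d) n z ≡ z
zipWith-second [] [] = refl
zipWith-second (x ∷ n) (d ∷ z) = cong (d ∷_) (zipWith-second n z)

⋆-left : ∀ {h} (f g : DS h) (n : Vec ℕ h) → (f ⋆ g) n ≡ ∑ (divTuples n) (λ z → f z ℤ.* g (n ⊘ z))
⋆-left f g n = trans (∑-factorTuples (λ _ d → d) sdiv ∑-pairs-left n _)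
  (∑-cong (divTuples n) (λ z → cong (λ v → f v ℤ.* g (n ⊘ z)) (zipWith-second n z)))

⋆-right : ∀ {h} (f g : DS h) (n : Vec ℕ h) → (f ⋆ g) n ≡ ∑ (divTuples n) (λ z → f (n ⊘ z) ℤ.* g z)
⋆-right f g n = trans (∑-factorTuples sdiv (λ _ e → e) ∑-pairs-right n _)
  (∑-cong (divTuples n) (λ z → cong (λ v → f (n ⊘ z) ℤ.* g v) (zipWith-second n z)))

divTuples-divide : ∀ {h} (n : Vec ℕ h) → All (_∣ᵥ n) (divTuples n)
divTuples-divide [] = refl ∷ []
divTuples-divide (x ∷ xs) = concat⁺ (map⁺ (All.map extend (all-filter (_∣? x) (range1 x))))
  where
  extend : ∀ {d} → d ∣ x → All (_∣ᵥ (x ∷ xs)) (map (d ∷_) (divTuples xs))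
  extend d∣x = map⁺ (All.map (cong₂ _∷_ (sdiv-∣ d∣x)) (divTuples-divide xs))

∑-divTuples-delta : ∀ {h} (n : Vec ℕ h) → Positive n → (f : Vec ℕ h → ℤ) →
  (∀ z → z ≢ n → f z ≡ 0ℤ) → ∑ (divTuples n) f ≡ f n
∑-divTuples-delta [] _ f _ = ℤP.+-identityʳ _
∑-divTuples-delta (x ∷ xs) (1≤x , xs-pos) f off = begin
    ∑ (divTuples (x ∷ xs)) f                                  ≡⟨ ∑-divTuples-∷ x xs f ⟩
    ∑ (divisors x) slice                                      ≡⟨ ∑-filter (_∣? x) (range1 x) slice ⟩
    ∑ (range1 x) (λ d → if does (d ∣? x) then slice d else 0ℤ) ≡⟨ ∑-range1-delta x x _ 1≤x ≤-refl off-x ⟩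
    (if does (x ∣? x) then slice x else 0ℤ)                   ≡⟨ if-yes (x ∣? x) ∣-refl ⟩
    slice x                                                   ≡⟨ ∑-divTuples-delta xs xs-pos (f ∘ (x ∷_)) off-xs ⟩
    f (x ∷ xs)                                                ∎
  where
  slice : ℕ → ℤ
  slice d = ∑ (divTuples xs) (λ zs → f (d ∷ zs))
  off-x : ∀ d → d ≢ x → (if does (d ∣? x) then slice d else 0ℤ) ≡ 0ℤ
  off-x d d≢x with does (d ∣? x)
  ... | true = ∑-zero (divTuples xs) (λ zs → off (d ∷ zs) (d≢x ∘ ∷-injectiveˡ))
  ... | false = refl
  off-xs : ∀ zs → zs ≢ xs → f (x ∷ zs) ≡ 0ℤ
  off-xs zs zs≢xs = off (x ∷ zs) (zs≢xs ∘ ∷-injectiveʳ)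

ones : ∀ h → Vec ℕ h
ones h = replicate h 1

partition-positive : ∀ {h} (v : Vec ℕ h) → IsPartition v → Positive v
partition-positive [] _ = tt
partition-positive (x ∷ []) 1≤x = 1≤x , tt
partition-positive (x ∷ y ∷ xs) (y≤x , rest) with partition-positive (y ∷ xs) rest
... | 1≤y , rest-pos = ≤-trans 1≤y y≤x , 1≤y , rest-pos

ones-partition : ∀ h → IsPartition (ones h)
ones-partition zero = tt
ones-partition (suc zero) = ≤-refl
ones-partition (suc (suc h)) = ≤-refl , ones-partition (suc h)

*-partition : ∀ {h} (p q : Vec ℕ h) → IsPartition p → IsPartition q → IsPartition (zipWith _*_ p q)
*-partition [] [] _ _ = tt
*-partition (a ∷ []) (c ∷ []) 1≤a 1≤c = *-mono-≤ 1≤a 1≤c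
*-partition (a ∷ b ∷ p) (c ∷ d ∷ q) (b≤a , p-part) (d≤c , q-part) =
  *-mono-≤ b≤a d≤c , *-partition (b ∷ p) (d ∷ q) p-part q-part

⊘-cancel : ∀ {h} (p z : Vec ℕ h) → Positive z → zipWith _*_ p z ⊘ z ≡ p
⊘-cancel [] [] _ = refl
⊘-cancel (a ∷ p) (suc c ∷ z) (_ , z-pos) = cong₂ _∷_ (m*n/n≡m a (suc c)) (⊘-cancel p z z-pos)

⪯-partitions : ∀ {h} {w z : Vec ℕ h} → w ⪯ z → IsPartition w × IsPartition z
⪯-partitions (E , refl , refl) =
  Espalier.q-part E , *-partition (Espalier.p E) (Espalier.q E) (Espalier.p-part E) (Espalier.q-part E)

-- Reflexivity on partitions, via the espalier with p = (1,…,1).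
⪯-refl : ∀ {h} (z : Vec ℕ h) → IsPartition z → z ⪯ z
⪯-refl {h} z z-part =
  record { p = ones h ; q = z ; p-part = ones-partition h ; q-part = z-part } ,
  zipWith-identityˡ {f = _*_} *-identityˡ z , refl

-- Stacking two espaliers: if z = p₁·x and y = p₂·z then y = (p₂·p₁)·x.
⪯-trans : ∀ {h} {x z y : Vec ℕ h} → x ⪯ z → z ⪯ y → x ⪯ y
⪯-trans (E₁ , refl , refl) (E₂ , refl , q₂≡z) =
  record { p = zipWith _*_ p₂ p₁ ; q = Espalier.q E₁
         ; p-part = *-partition p₂ p₁ (Espalier.p-part E₂) (Espalier.p-part E₁)
         ; q-part = Espalier.q-part E₁ } ,
  trans (zipWith-assoc {f = _*_} *-assoc p₂ p₁ (Espalier.q E₁)) (cong (zipWith _*_ p₂) (sym q₂≡z)) ,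
  refl
  where
  p₁ = Espalier.p E₁
  p₂ = Espalier.p E₂

-- An espalier is determined by its λx and multivolume: its p-vector is n ⊘ z.
-- Hence, for z ∣ n, z ⪯ n holds exactly when z and n ⊘ z are partitions.
⪯⇒cofactor-partition : ∀ {h} {z n : Vec ℕ h} → z ⪯ n → IsPartition (n ⊘ z)
⪯⇒cofactor-partition (E , refl , refl) =
  subst IsPartition (sym (⊘-cancel (Espalier.p E) (Espalier.q E) (partition-positive _ (Espalier.q-part E))))
    (Espalier.p-part E)

cofactor⇒⪯ : ∀ {h} {z n : Vec ℕ h} → z ∣ᵥ n → IsPartition z → IsPartition (n ⊘ z) → z ⪯ n
cofactor⇒⪯ {z = z} {n} z∣n z-part cofactor-part =
  record { p = n ⊘ z ; q = z ; p-part = cofactor-part ; q-part = z-part } , z∣n , refl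

prodV-* : ∀ {h} (p w : Vec ℕ h) → prodV (zipWith _*_ p w) ≡ prodV p * prodV w
prodV-* [] [] = refl
prodV-* (a ∷ p) (c ∷ w) = trans (cong ((a * c) *_) (prodV-* p w)) (*-interchange a c (prodV p) (prodV w))

prodV-positive : ∀ {h} (w : Vec ℕ h) → Positive w → 1 ≤ prodV w
prodV-positive [] _ = ≤-refl
prodV-positive (x ∷ w) (1≤x , w-pos) = *-mono-≤ 1≤x (prodV-positive w w-pos)

prodV≡1⇒ones : ∀ {h} (p : Vec ℕ h) → prodV p ≡ 1 → p ≡ ones h
prodV≡1⇒ones [] _ = refl
prodV≡1⇒ones (a ∷ p) eq = cong₂ _∷_ (m*n≡1⇒m≡1 a (prodV p) eq) (prodV≡1⇒ones p (m*n≡1⇒n≡1 a (prodV p) eq))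

-- If w ⪯ z via p (so z = p·w) and w ≠ z, then p ≠ (1,…,1), so ∏p ≥ 2.
⪯-product-< : ∀ {h} {w z : Vec ℕ h} → w ⪯ z → w ≢ z → prodV w < prodV z
⪯-product-< (E , refl , refl) w≢z = subst (prodV q <_) (sym (prodV-* p q)) (grows 1<∏p (prodV-positive q q-pos))
  where
  p q : Vec ℕ _
  p = Espalier.p E
  q = Espalier.q E
  q-pos : Positive q
  q-pos = partition-positive q (Espalier.q-part E)
  ∏p≢1 : prodV p ≢ 1
  ∏p≢1 ∏p≡1 = w≢z (sym (trans (cong (λ v → zipWith _*_ v q) (prodV≡1⇒ones p ∏p≡1))
                               (zipWith-identityˡ {f = _*_} *-identityˡ q)))
  1<∏p : 1 < prodV p
  1<∏p = ≤∧≢⇒< (prodV-positive p (partition-positive p (Espalier.p-part E))) (∏p≢1 ∘ sym)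
  grows : ∀ {P Q} → 1 < P → 0 < Q → Q < P * Q
  grows {P} {Q} 1<P 0<Q = subst (Q <_) (*-comm Q P) (m<m*n Q P {{>-nonZero 0<Q}} 1<P)

-- Antisymmetry follows, since the product cannot strictly grow both ways.
⪯-antisym : ∀ {h} {w z : Vec ℕ h} → w ⪯ z → z ⪯ w → w ≡ z
⪯-antisym {w = w} {z} w⪯z z⪯w with ≡-dec _≟_ w z
... | yes w≡z = w≡z
... | no w≢z = contradiction (⪯-product-< z⪯w (w≢z ∘ sym)) (<-asym (⪯-product-< w⪯z w≢z))

between? : ∀ {h} (x y z : Vec ℕ h) → Dec (x ⪯ z × z ⪯ y)
between? x y z = (x ⪯? z) ×-dec (z ⪯? y)

strictly-between? : ∀ {h} (x y z : Vec ℕ h) → Dec (x ⪯ z × (z ⪯ y × z ≢ y))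
strictly-between? x y z = (x ⪯? z) ×-dec ((z ⪯? y) ×-dec ¬? (≡-dec _≟_ z y))

-- Any fuel beyond the product of the upper index gives the same value, since
-- every recursive call strictly lowers that product.
mobF-fuel : ∀ {h} (k k' : ℕ) (x z : Vec ℕ h) → prodV z < k → prodV z < k' → mobF k x z ≡ mobF k' x z
mobF-fuel (suc k) (suc k') x z (s≤s z<k) (s≤s z<k') with x ⪯? z
... | no _ = refl
... | yes _ with ≡-dec _≟_ x z
... | yes _ = refl
... | no _ = cong -_ (∑-congAll (filter (strictly-between? x z) (divTuples z))
  (all-filter (strictly-between? x z) (divTuples z))
  (λ w (_ , w⪯z , w≢z) → mobF-fuel k k' x w (≤-trans (⪯-product-< w⪯z w≢z) z<k) (≤-trans (⪯-product-< w⪯z w≢z) z<k')))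

μʰ-refl : ∀ {h} (x : Vec ℕ h) → x ⪯ x → μʰ x x ≡ 1ℤ
μʰ-refl x x⪯x with x ⪯? x
... | no x⋠x = contradiction x⪯x x⋠x
... | yes _ with ≡-dec _≟_ x x
... | yes _ = refl
... | no x≢x = contradiction refl x≢x

μʰ-unfold : ∀ {h} (x y : Vec ℕ h) → x ⪯ y → x ≢ y →
  μʰ x y ≡ - ∑ (filter (strictly-between? x y) (divTuples y)) (μʰ x)
μʰ-unfold x y x⪯y x≢y with x ⪯? y
... | no x⋠y = contradiction x⪯y x⋠y
... | yes _ with ≡-dec _≟_ x y
... | yes x≡y = contradiction x≡y x≢y
... | no _ = cong -_ (∑-congAll (filter (strictly-between? x y) (divTuples y))
  (all-filter (strictly-between? x y) (divTuples y))
  (λ w (_ , w⪯y , w≢y) → mobF-fuel (prodV y) (suc (prodV w)) x w (⪯-product-< w⪯y w≢y) ≤-refl))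

intervalμ : ∀ {h} (x y z : Vec ℕ h) → ℤ
intervalμ x y z = if does (between? x y z) then μʰ x z else 0ℤ

intervalμ-split : ∀ {h} (x y z : Vec ℕ h) →
  intervalμ x y z ≡
  (if does (strictly-between? x y z) then μʰ x z else 0ℤ) + (if does (≡-dec _≟_ z y) then intervalμ x y z else 0ℤ)
intervalμ-split x y z with x ⪯? z | z ⪯? y | ≡-dec _≟_ z y
... | yes _ | yes _ | yes _ = sym (ℤP.+-identityˡ _)
... | yes _ | yes _ | no _ = sym (ℤP.+-identityʳ _)
... | yes _ | no _ | yes _ = refl
... | yes _ | no _ | no _ = refl
... | no _ | _ | yes _ = refl
... | no _ | _ | no _ = refl

∑-intervalμ-top : ∀ {h} (x y : Vec ℕ h) → x ⪯ y →
  ∑ (divTuples y) (intervalμ x y) ≡ ∑ (filter (strictly-between? x y) (divTuples y)) (μʰ x) + μʰ x y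
∑-intervalμ-top x y x⪯y = begin
    ∑ L (intervalμ x y)
  ≡⟨ ∑-cong L (intervalμ-split x y) ⟩
    ∑ L (λ z → below z + top z)
  ≡⟨ ∑-+ L below top ⟩
    ∑ L below + ∑ L top
  ≡⟨ cong₂ _+_ (sym (∑-filter (strictly-between? x y) L (μʰ x)))
               (∑-divTuples-delta y y-pos top (λ z z≢y → if-no (≡-dec _≟_ z y) z≢y)) ⟩
    ∑ (filter (strictly-between? x y) L) (μʰ x) + top y
  ≡⟨ cong (∑ (filter (strictly-between? x y) L) (μʰ x) +_)
          (trans (if-yes (≡-dec _≟_ y y) refl) (if-yes (between? x y y) (x⪯y , ⪯-refl y y-part))) ⟩
    ∑ (filter (strictly-between? x y) L) (μʰ x) + μʰ x y ∎
  where
  L : List (Vec ℕ _)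
  L = divTuples y
  below top : Vec ℕ _ → ℤ
  below z = if does (strictly-between? x y z) then μʰ x z else 0ℤ
  top z = if does (≡-dec _≟_ z y) then intervalμ x y z else 0ℤ
  y-part : IsPartition y
  y-part = proj₂ (⪯-partitions x⪯y)
  y-pos : Positive y
  y-pos = partition-positive y y-part

∑-intervalμ : ∀ {h} (x y : Vec ℕ h) → IsPartition x →
  ∑ (divTuples y) (intervalμ x y) ≡ (if ⌊ ≡-dec _≟_ y x ⌋ then 1ℤ else 0ℤ)
∑-intervalμ x y x-part with x ⪯? y | ≡-dec _≟_ y x
... | no x⋠y | yes refl = contradiction (⪯-refl x x-part) x⋠y
... | no x⋠y | no _ = ∑-zero (divTuples y)
  (λ z → if-no (between? x y z) (λ (x⪯z , z⪯y) → x⋠y (⪯-trans x⪯z z⪯y)))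
... | yes x⪯x | yes refl = begin
    ∑ (divTuples x) (intervalμ x x)  ≡⟨ ∑-intervalμ-top x x x⪯x ⟩
    ∑ strictly-below (μʰ x) + μʰ x x ≡⟨ cong₂ _+_ nothing-below (μʰ-refl x x⪯x) ⟩
    0ℤ + 1ℤ                          ∎
  where
  strictly-below : List (Vec ℕ _)
  strictly-below = filter (strictly-between? x x) (divTuples x)
  -- By antisymmetry no z satisfies x ⪯ z ≺ x.
  nothing-below : ∑ strictly-below (μʰ x) ≡ 0ℤ
  nothing-below = trans
    (∑-congAll strictly-below {g = λ _ → 0ℤ} (all-filter (strictly-between? x x) (divTuples x))
      (λ z (x⪯z , z⪯x , z≢x) → contradiction (sym (⪯-antisym x⪯z z⪯x)) z≢x))
    (∑-zero strictly-below (λ _ → refl))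
... | yes x⪯y | no y≢x = begin
    ∑ (divTuples y) (intervalμ x y)  ≡⟨ ∑-intervalμ-top x y x⪯y ⟩
    below + μʰ x y                   ≡⟨ cong (below +_) (μʰ-unfold x y x⪯y (y≢x ∘ sym)) ⟩
    below + - below                  ≡⟨ ℤP.+-inverseʳ below ⟩
    0ℤ                               ∎
  where
  below : ℤ
  below = ∑ (filter (strictly-between? x y) (divTuples y)) (μʰ x)

convolution-term : ∀ {h} (n z : Vec ℕ h) → z ∣ᵥ n → 𝓜 z ℤ.* 𝒵 (n ⊘ z) ≡ intervalμ (ones h) n z
convolution-term {h} n z z∣n = by-cases (ones h ⪯? z) (z ⪯? n) (isPartition? (n ⊘ z))
  where
  μ₁ : ℤ
  μ₁ = μʰ (ones h) z
  by-cases : (D₁ : Dec (ones h ⪯ z)) (D₂ : Dec (z ⪯ n)) (D₃ : Dec (IsPartition (n ⊘ z))) →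
    (if ⌊ D₁ ⌋ then μ₁ else 0ℤ) ℤ.* (if ⌊ D₃ ⌋ then 1ℤ else 0ℤ) ≡ (if does (D₁ ×-dec D₂) then μ₁ else 0ℤ)
  by-cases (no _) _ D₃ = ℤP.*-zeroˡ (if ⌊ D₃ ⌋ then 1ℤ else 0ℤ)
  by-cases (yes _) (yes _) (yes _) = ℤP.*-identityʳ μ₁
  by-cases (yes _) (yes z⪯n) (no cofactor-not-part) =
    contradiction (⪯⇒cofactor-partition z⪯n) cofactor-not-part
  by-cases (yes 1⪯z) (no z⋠n) (yes cofactor-part) =
    contradiction (cofactor⇒⪯ z∣n (proj₂ (⪯-partitions 1⪯z)) cofactor-part) z⋠n
  by-cases (yes _) (no _) (no _) = ℤP.*-zeroʳ μ₁

-- Both products reduce to Σ_{1 ⪯ z ⪯ n} μʰ(1, z), which is [n = (1,…,1)].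
corollary1 : (h : ℕ) → 1 ≤ h →
    ((n : Vec ℕ h) → Positive n → (𝒵 ⋆ 𝓜) n ≡ 𝟙 n) ×
    ((n : Vec ℕ h) → Positive n → (𝓜 ⋆ 𝒵) n ≡ 𝟙 n)
corollary1 h _ = (λ n _ → 𝒵⋆𝓜 n) , (λ n _ → 𝓜⋆𝒵 n)
  where
  terms : (n : Vec ℕ h) → ∑ (divTuples n) (λ z → 𝓜 z ℤ.* 𝒵 (n ⊘ z)) ≡ 𝟙 n
  terms n = begin
    ∑ (divTuples n) (λ z → 𝓜 z ℤ.* 𝒵 (n ⊘ z))  ≡⟨ ∑-congAll (divTuples n) (divTuples-divide n) (convolution-term n) ⟩
    ∑ (divTuples n) (intervalμ (ones h) n)    ≡⟨ ∑-intervalμ (ones h) n (ones-partition h) ⟩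
    𝟙 n                                       ∎
  𝓜⋆𝒵 : (n : Vec ℕ h) → (𝓜 ⋆ 𝒵) n ≡ 𝟙 n
  𝓜⋆𝒵 n = trans (⋆-left 𝓜 𝒵 n) (terms n)
  𝒵⋆𝓜 : (n : Vec ℕ h) → (𝒵 ⋆ 𝓜) n ≡ 𝟙 n
  𝒵⋆𝓜 n = trans (⋆-right 𝒵 𝓜 n)
    (trans (∑-cong (divTuples n) (λ z → ℤP.*-comm (𝒵 (n ⊘ z)) (𝓜 z))) (terms n))
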